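{- Let $P\in \mathrm{Part}(\Sigma)$ and $S\subseteq \Sigma$. Then: (i) $\mathrm{split}_{PT}(S,P) = \mathrm{par}(\mathcal{M} (\mathrm{pad}(P) \cup \{\mathrm{pre} (S)\})) = \mathrm{par}(\mathrm{pad}(P)\sqcap \mathcal{M}(\{\mathrm{pre}(S)\}))$; (ii) $\mathrm{PTrefiners} (P) = \{ S \in \mathrm{pad}(P)~|~ \mathrm{par} (\mathcal{M}(\mathrm{pad}(P) \cup \{\mathrm{pre} (S)\})) \prec P \}$; (iii) $P$ is PT stable iff $\{ S \in \mathrm{pad}(P)~|~ \mathrm{par} (\mathcal{M}(\mathrm{pad}(P) \cup\{ \mathrm{pre} (S)\})) \prec P \} = \varnothing$.
   Context: Let $(\Sigma, \to, \ell)$ be a finite Kripke structure with total transition relation $\to$, and let $\mathrm{pre}(Y)=\{a\in\Sigma~|~\exists b\in Y.\, a\to b\}$. $\mathrm{Part}(\Sigma)$ is the lattice of partitions of $\Sigma$ ordered by refinement $\preceq$ ($P_1\preceq P_2$ iff every block of $P_1$ is contained in a block of $P_2$), with meet $P_1\curlywedge P_2=\{B_1\cap B_2\neq\varnothing~|~B_i\in P_i\}$. $\mathrm{Abs}(\wp(\Sigma))$ is the lattice of abstract domains (equivalently upper closure operators / Moore families) of $\wp(\Sigma)_\subseteq$, with $\sqcap$ the reduced product (intersection of closures pointwise, i.e. Moore closure of the union of images). For $X\subseteq\wp(\Sigma)$, $\mathcal{M}(X)=\{\cap S~|~S\subseteq X\}$ is its Moore closure (with $\cap\varnothing=\Sigma$).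 For $P\in\mathrm{Part}(\Sigma)$, $\mathrm{pad}(P)$ is the partitioning abstract domain whose image is the set of all unions of blocks of $P$. For an abstract domain $A$ with abstraction $\alpha$, $\mathrm{par}(A)=\{[s]_A~|~s\in\Sigma\}$ where $[s]_A=\{s'~|~\alpha(\{s\})=\alpha(\{s'\})\}$. $\mathrm{split}_{PT}(S,P)$ is the partition obtained from $P$ by replacing each block $B$ by the nonempty ones among $B\cap\mathrm{pre}(S)$ and $B\smallsetminus\mathrm{pre}(S)$, i.e. $P\curlywedge\{\mathrm{pre}(S),\Sigma\smallsetminus\mathrm{pre}(S)\}$. $S$ is a splitter of $P$ if $\mathrm{split}_{PT}(S,P)\neq P$, and $\mathrm{PTrefiners}(P)$ is the set of splitters of $P$ that are unions of blocks of $P$. $P$ is PT stable iff for all blocks $B,B'\in P$, either $B\subseteq\mathrm{pre}(B')$ or $B\cap\mathrm{pre}(B')=\varnothing$. -}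

module Defs where

open import Level using (0ℓ)
open import Data.Nat using (ℕ)
open import Data.Fin using (Fin)
open import Data.Fin.Subset
  using (Subset; _∈_; _⊆_; _∩_; _─_; ⋃; ⋂; ⊤; ⁅_⁆; Nonempty; Empty)
open import Data.Fin.Subset.Properties using (_∈?_)
open import Data.Fin.Properties using (any?)
open import Data.Vec using (tabulate)
open import Data.List using (List)
open import Data.List.Relation.Unary.All using (All)
open import Data.Product using (Σ; ∃; _×_; _,_)
open import Data.Sum using (_⊎_)
open import Relation.Nullary using (¬_; does)
open import Relation.Nullary.Decidable using (_×-dec_)
open import Relation.Binary using (Rel; Decidable)
open import Relation.Binary.PropositionalEquality using (_≡_)
open import Function.Bundles using (_⇔_)

-- States Σ = Fin n; subsets of Σ are Data.Fin.Subset.Subset n.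
-- A family of subsets of Σ (a subset of ℘(Σ)) is a predicate on Subset n.
Family : ℕ → Set₁
Family n = Subset n → Set

_≐_ : ∀ {n} → Family n → Family n → Set
X ≐ Y = ∀ B → X B ⇔ Y B

_∪ᶠ_ : ∀ {n} → Family n → Family n → Family n
(X ∪ᶠ Y) B = X B ⊎ Y B

｛_｝ : ∀ {n} → Subset n → Family n
｛ A ｝ B = B ≡ A

pre : ∀ {n} {_⟶_ : Rel (Fin n) 0ℓ} → Decidable _⟶_ → Subset n → Subset n
pre _⟶?_ Y = tabulate λ a → does (any? λ b → (a ⟶? b) ×-dec (b ∈? Y))

Total : ∀ {n} → Rel (Fin n) 0ℓ → Set
Total _⟶_ = ∀ a → ∃ λ b → a ⟶ b

-- Partitions of Σ, represented as their set of blocks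
IsPartition : ∀ {n} → Family n → Set
IsPartition {n} P =
  (∀ B → P B → Nonempty B) ×
  (∀ (a : Fin n) → ∃ λ B → P B × a ∈ B) ×
  (∀ B B' (a : Fin n) → P B → P B' → a ∈ B → a ∈ B' → B ≡ B')

_⪯_ : ∀ {n} → Family n → Family n → Set
P₁ ⪯ P₂ = ∀ B₁ → P₁ B₁ → ∃ λ B₂ → P₂ B₂ × B₁ ⊆ B₂

_≺_ : ∀ {n} → Family n → Family n → Set
P₁ ≺ P₂ = P₁ ⪯ P₂ × ¬ (P₁ ≐ P₂)

-- Moore closure M(X) = { ∩S | S ⊆ X }  (subfamilies of the finite ℘(Σ) are finite,
-- given as lists; ⋂ [] = Σ)
M : ∀ {n} → Family n → Family n
M X B = ∃ λ (Ss : List (Subset _)) → All X Ss × B ≡ ⋂ Ss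

-- reduced product of abstract domains given by their images (Moore families)
_⊓_ : ∀ {n} → Family n → Family n → Family n
X ⊓ Y = M (X ∪ᶠ Y)

pad : ∀ {n} → Family n → Family n
pad P B = ∃ λ (Bs : List (Subset _)) → All P Bs × B ≡ ⋃ Bs

-- abstraction map of the abstract domain with image X:
-- a ∈ α_X(Z)  iff  a belongs to every Y ∈ X with Z ⊆ Y
_∈α[_]_ : ∀ {n} → Fin n → Family n → Subset n → Set
a ∈α[ X ] Z = ∀ Y → X Y → Z ⊆ Y → a ∈ Y

_∼[_]_ : ∀ {n} → Fin n → Family n → Fin n → Set
s ∼[ X ] s' = ∀ a → (a ∈α[ X ] ⁅ s ⁆) ⇔ (a ∈α[ X ] ⁅ s' ⁆)

par : ∀ {n} → Family n → Family n
par X B = ∃ λ s → ∀ s' → (s' ∈ B) ⇔ (s ∼[ X ] s')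

split : ∀ {n} {_⟶_ : Rel (Fin n) 0ℓ} → Decidable _⟶_ → Subset n → Family n → Family n
split R? S P B =
  (∃ λ B' → P B' × (B ≡ B' ∩ pre R? S ⊎ B ≡ B' ─ pre R? S)) × Nonempty B

Splitter : ∀ {n} {_⟶_ : Rel (Fin n) 0ℓ} → Decidable _⟶_ → Subset n → Family n → Set
Splitter R? S P = ¬ (split R? S P ≐ P)

PTrefiners : ∀ {n} {_⟶_ : Rel (Fin n) 0ℓ} → Decidable _⟶_ → Family n → Family n
PTrefiners R? P S = Splitter R? S P × pad P S

PTstable : ∀ {n} {_⟶_ : Rel (Fin n) 0ℓ} → Decidable _⟶_ → Family n → Set
PTstable R? P = ∀ B B' → P B → P B' → B ⊆ pre R? B' ⊎ Empty (B ∩ pre R? B')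

{-# OPTIONS --safe #-}
module Submission where

-- For a family X of subsets, α_X({s}) is the intersection of the members of X
-- containing s, so par(X) is the partition of Σ into classes of points that no
-- member of X separates. Closing X under intersections (M) or under unions (pad)
-- separates no new points, so par(M(pad P ∪ {pre S})) groups points lying in the
-- same block of P and on the same side of pre S: that is split_PT(S,P). Part (ii)
-- follows because split_PT(S,P) refines P. For (iii), S splits P iff some block
-- meets pre S without being contained in it. The sets p such that every block
-- lies inside p or outside p are closed under unions, and pre commutes with
-- unions, so if no single block is a splitter then no union of blocks is.

open import Defs
open import Level using (0ℓ)
open import Data.Nat using (ℕ)
open import Data.Fin using (Fin)
open import Data.Fin.Subset
  using (Subset; _∈_; _∉_; _⊆_; _∩_; _∪_; _─_; ⋃; ⋂; ⊥; ⁅_⁆; Nonempty; Empty; inside; outside)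
open import Data.Fin.Subset.Properties
  using ( x∈p∩q⁺; x∈p∩q⁻; x∈p∪q⁺; x∈p∪q⁻; x∈p∧x∉q⇒x∈p─q; p─q⊆p; p∩q⊆p; p∩q⊆q
        ; p⊆p∪q; q⊆p∪q; ∉⊥; ∈⊤; x∈⁅x⁆; x∈⁅y⁆⇒x≡y; ⊆-antisym; ∩-identityʳ; ∪-identityʳ
        ; Empty-unique; nonempty?; _⊆?_; _∈?_)
open import Data.Fin.Properties using (any?)
open import Data.Bool using (true)
open import Data.Vec using (_∷_; here; there)
open import Data.Vec.Properties using (lookup∘tabulate; []=⇒lookup; lookup⇒[]=)
open import Data.List using (List; []; _∷_)
open import Data.List.Relation.Unary.All as All using (All; []; _∷_)
open import Data.Product as Product using (∃; _×_; _,_; proj₁; proj₂; uncurry)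
open import Data.Product.Function.NonDependent.Propositional using (_×-⇔_)
open import Data.Sum as Sum using (_⊎_; inj₁; inj₂; [_,_]′)
open import Data.Empty using (⊥-elim)
open import Function using (const)
open import Function.Bundles using (_⇔_; mk⇔; Equivalence)
open import Function.Construct.Identity using (⇔-id)
open import Function.Construct.Symmetry using (⇔-sym)
open import Function.Construct.Composition using () renaming (equivalence to ⇔-trans)
open import Function.Related.Propositional using (module EquationalReasoning)
open import Relation.Nullary using (¬_; Dec; yes; no; does)
open import Relation.Nullary.Decidable
  using (_×-dec_; _⊎-dec_; ¬?; decidable-stable; dec-true)
open import Relation.Binary using (Rel; Decidable)
open import Relation.Binary.PropositionalEquality using (_≡_; refl; sym; trans; subst)

open Equivalence using (to; from)

private
  variable
    n : ℕ
    s s' x y : Fin n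
    B p q : Subset n
    X X' Y Y' Z P : Family n

≐-sym : X ≐ Y → Y ≐ X
≐-sym e B = ⇔-sym (e B)

≐-trans : X ≐ Y → Y ≐ Z → X ≐ Z
≐-trans e f B = ⇔-trans (e B) (f B)

subset-ext : (∀ x → x ∈ p ⇔ x ∈ q) → p ≡ q
subset-ext e = ⊆-antisym (λ {x} → to (e x)) (λ {x} → from (e x))

x∈p─q⇒x∉q : ∀ (p q : Subset n) → x ∈ p ─ q → x ∉ q
x∈p─q⇒x∉q (inside ∷ p) (outside ∷ q) here       ()
x∈p─q⇒x∉q (_      ∷ p) (_       ∷ q) (there x∈) (there x∈q) = x∈p─q⇒x∉q p q x∈ x∈q

x∈p∩q⇔ : x ∈ p ∩ q ⇔ (x ∈ p × x ∈ q)
x∈p∩q⇔ = mk⇔ (x∈p∩q⁻ _ _) x∈p∩q⁺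

x∈p─q⇔ : x ∈ p ─ q ⇔ (x ∈ p × x ∉ q)
x∈p─q⇔ = mk⇔ (λ x∈ → p─q⊆p _ _ x∈ , x∈p─q⇒x∉q _ _ x∈) (uncurry x∈p∧x∉q⇒x∈p─q)

⁅x⁆⊆p : x ∈ p → ⁅ x ⁆ ⊆ p
⁅x⁆⊆p {x = x} {p = p} x∈p y∈⁅x⁆ = subst (_∈ p) (sym (x∈⁅y⁆⇒x≡y x y∈⁅x⁆)) x∈p

⋂-transfer : ∀ {ps : List (Subset n)} → All (λ q → x ∈ q → y ∈ q) ps → x ∈ ⋂ ps → y ∈ ⋂ ps
⋂-transfer []                      _  = ∈⊤
⋂-transfer {ps = q ∷ ps} (f ∷ fs) x∈ =
  x∈p∩q⁺ (Product.map f (⋂-transfer fs) (x∈p∩q⁻ q (⋂ ps) x∈))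

⋃-transfer : ∀ {ps : List (Subset n)} → All (λ q → x ∈ q → y ∈ q) ps → x ∈ ⋃ ps → y ∈ ⋃ ps
⋃-transfer []                      x∈ = ⊥-elim (∉⊥ x∈)
⋃-transfer {ps = q ∷ ps} (f ∷ fs) x∈ =
  x∈p∪q⁺ (Sum.map f (⋃-transfer fs) (x∈p∪q⁻ q (⋃ ps) x∈))

⊆M : X p → M X p
⊆M {p = p} Xp = p ∷ [] , Xp ∷ [] , sym (∩-identityʳ p)

⊆pad : X p → pad X p
⊆pad {p = p} Xp = p ∷ [] , Xp ∷ [] , sym (∪-identityʳ p)

_≈[_]_ : Fin n → Family n → Fin n → Set
s ≈[ X ] s' = ∀ p → X p → s ∈ p ⇔ s' ∈ p

≈-refl : s ≈[ X ] s
≈-refl _ _ = ⇔-id _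

≈-sym : s ≈[ X ] s' → s' ≈[ X ] s
≈-sym e p Xp = ⇔-sym (e p Xp)

≈-∪ : s ≈[ X ∪ᶠ Y ] s' ⇔ (s ≈[ X ] s' × s ≈[ Y ] s')
≈-∪ = mk⇔ (λ e → (λ p Xp → e p (inj₁ Xp)) , (λ p Yp → e p (inj₂ Yp)))
          (λ (e , f) p → [ e p , f p ]′)

≈-｛｝ : s ≈[ ｛ p ｝ ] s' ⇔ (s ∈ p ⇔ s' ∈ p)
≈-｛｝ {p = p} = mk⇔ (λ e → e p refl) (λ { e _ refl → e })

≈-∪｛｝ : s ≈[ X ∪ᶠ ｛ p ｝ ] s' ⇔ (s ≈[ X ] s' × (s ∈ p ⇔ s' ∈ p))
≈-∪｛｝ = ⇔-trans ≈-∪ (⇔-id _ ×-⇔ ≈-｛｝)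

∈-agree : s ∈ p → s' ∈ p ⇔ (s ∈ p ⇔ s' ∈ p)
∈-agree s∈p = mk⇔ (λ s'∈p → mk⇔ (const s'∈p) (const s∈p)) (λ e → to e s∈p)

∉-agree : s ∉ p → s' ∉ p ⇔ (s ∈ p ⇔ s' ∈ p)
∉-agree s∉p = mk⇔ (λ s'∉p → mk⇔ (λ s∈p → ⊥-elim (s∉p s∈p)) (λ s'∈p → ⊥-elim (s'∉p s'∈p)))
                  (λ e s'∈p → s∉p (from e s'∈p))

∈α-transfer : ∀ {a} → s ≈[ X ] s' → a ∈α[ X ] ⁅ s ⁆ → a ∈α[ X ] ⁅ s' ⁆
∈α-transfer {s' = s'} e a∈ p Xp ⁅s'⁆⊆p = a∈ p Xp (⁅x⁆⊆p (from (e p Xp) (⁅s'⁆⊆p (x∈⁅x⁆ s'))))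

∼⇔≈ : s ∼[ X ] s' ⇔ s ≈[ X ] s'
∼⇔≈ {s = s} {X = X} {s' = s'} = mk⇔ ∼⇒≈ (λ e a → mk⇔ (∈α-transfer e) (∈α-transfer (≈-sym e)))
  where
  ∈α⁅self⁆ : ∀ a → a ∈α[ X ] ⁅ a ⁆
  ∈α⁅self⁆ a _ _ ⁅a⁆⊆p = ⁅a⁆⊆p (x∈⁅x⁆ a)

  ∼⇒≈ : s ∼[ X ] s' → s ≈[ X ] s'
  ∼⇒≈ h p Xp = mk⇔ (λ s∈p → from (h s') (∈α⁅self⁆ s') p Xp (⁅x⁆⊆p s∈p))
                   (λ s'∈p → to (h s) (∈α⁅self⁆ s) p Xp (⁅x⁆⊆p s'∈p))

Class : Family n → Fin n → Subset n → Set
Class X s B = ∀ s' → s' ∈ B ⇔ s ≈[ X ] s'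

class-∈ : Class X s B → s ∈ B
class-∈ {s = s} c = from (c s) ≈-refl

class-unique : ∀ {B B'} → Class X s B → Class X s B' → B ≡ B'
class-unique c c' = subset-ext λ x → ⇔-trans (c x) (⇔-sym (c' x))

par⇔ : par X B ⇔ (∃ λ s → Class X s B)
par⇔ = mk⇔ (Product.map₂ λ c s' → ⇔-trans (c s') ∼⇔≈)
           (Product.map₂ λ c s' → ⇔-trans (c s') (⇔-sym ∼⇔≈))

infix 4 _≋_
_≋_ : Family n → Family n → Set
X ≋ Y = ∀ s s' → s ≈[ X ] s' ⇔ s ≈[ Y ] s'

≋-refl : X ≋ X
≋-refl _ _ = ⇔-id _

≋-sym : X ≋ Y → Y ≋ X
≋-sym e s s' = ⇔-sym (e s s')

≋-trans : X ≋ Y → Y ≋ Z → X ≋ Z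
≋-trans e f s s' = ⇔-trans (e s s') (f s s')

∪-≋ : X ≋ X' → Y ≋ Y' → (X ∪ᶠ Y) ≋ (X' ∪ᶠ Y')
∪-≋ e f s s' = ⇔-trans ≈-∪ (⇔-trans (e s s' ×-⇔ f s s') (⇔-sym ≈-∪))

M-≋ : M X ≋ X
M-≋ s s' = mk⇔ (λ e p Xp → e p (⊆M Xp)) M-transfer
  where
  M-transfer : s ≈[ _ ] s' → s ≈[ M _ ] s'
  M-transfer e _ (ps , Xps , refl) =
    mk⇔ (⋂-transfer (All.map (λ Xq → to (e _ Xq)) Xps))
        (⋂-transfer (All.map (λ Xq → from (e _ Xq)) Xps))

pad-≋ : pad X ≋ X
pad-≋ s s' = mk⇔ (λ e p Xp → e p (⊆pad Xp)) pad-transfer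
  where
  pad-transfer : s ≈[ _ ] s' → s ≈[ pad _ ] s'
  pad-transfer e _ (ps , Xps , refl) =
    mk⇔ (⋃-transfer (All.map (λ Xq → to (e _ Xq)) Xps))
        (⋃-transfer (All.map (λ Xq → from (e _ Xq)) Xps))

par-cong : X ≋ Y → par X ≐ par Y
par-cong e B = ⇔-trans par⇔ (⇔-trans (mk⇔ (Product.map₂ (class-cong e))
                                             (Product.map₂ (class-cong (≋-sym e))))
                                      (⇔-sym par⇔))
  where
  class-cong : X ≋ Y → Class X s B → Class Y s B
  class-cong e c s' = ⇔-trans (c s') (e _ s')

par-M≐par-⊓ : par (M (X ∪ᶠ ｛ p ｝)) ≐ par (X ⊓ M ｛ p ｝)
par-M≐par-⊓ = par-cong (≋-trans M-≋ (≋-trans (∪-≋ ≋-refl (≋-sym M-≋)) (≋-sym M-≋)))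

-- split R? S P unfolds to splitBy P (pre R? S).
splitBy : Family n → Subset n → Family n
splitBy P p B = (∃ λ B' → P B' × (B ≡ B' ∩ p ⊎ B ≡ B' ─ p)) × Nonempty B

splitBy-⪯ : splitBy P p ⪯ P
splitBy-⪯ _ ((B' , PB' , inj₁ refl) , _) = B' , PB' , p∩q⊆p _ _
splitBy-⪯ _ ((B' , PB' , inj₂ refl) , _) = B' , PB' , p─q⊆p _ _

Saturated : Family n → Subset n → Set
Saturated P p = ∀ B → P B → B ⊆ p ⊎ Empty (B ∩ p)

saturated-⊥ : Saturated P ⊥
saturated-⊥ _ _ = inj₂ λ (_ , x∈) → ∉⊥ (p∩q⊆q _ _ x∈)

saturated-∪ : Saturated P p → Saturated P q → Saturated P (p ∪ q)
saturated-∪ {p = p} {q = q} sp sq B PB with sp B PB | sq B PB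
... | inj₁ B⊆p | _        = inj₁ λ x∈B → p⊆p∪q q (B⊆p x∈B)
... | _        | inj₁ B⊆q = inj₁ λ x∈B → q⊆p∪q p q (B⊆q x∈B)
... | inj₂ B∩p | inj₂ B∩q = inj₂ λ (x , x∈) →
  let x∈B , x∈p∪q = x∈p∩q⁻ B (p ∪ q) x∈
  in [ (λ x∈p → B∩p (x , x∈p∩q⁺ (x∈B , x∈p))) , (λ x∈q → B∩q (x , x∈p∩q⁺ (x∈B , x∈q))) ]′
       (x∈p∪q⁻ p q x∈p∪q)

⊆⇒∩≡ : B ⊆ p → B ∩ p ≡ B
⊆⇒∩≡ B⊆p = ⊆-antisym (p∩q⊆p _ _) (λ x∈B → x∈p∩q⁺ (x∈B , B⊆p x∈B))

disjoint⇒─≡ : Empty (B ∩ p) → B ─ p ≡ B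
disjoint⇒─≡ B∩p = ⊆-antisym (p─q⊆p _ _) (λ x∈B → x∈p∧x∉q⇒x∈p─q x∈B (λ x∈p → B∩p (_ , x∈p∩q⁺ (x∈B , x∈p))))

splitBy⇒block : Saturated P p → splitBy P p B → P B
splitBy⇒block {P = P} sat ((B' , PB' , inj₁ refl) , y , y∈) with sat B' PB'
... | inj₁ B'⊆p  = subst P (sym (⊆⇒∩≡ B'⊆p)) PB'
... | inj₂ B'∩p  = ⊥-elim (B'∩p (y , y∈))
splitBy⇒block {P = P} sat ((B' , PB' , inj₂ refl) , y , y∈) with sat B' PB'
... | inj₁ B'⊆p  = ⊥-elim (x∈p─q⇒x∉q _ _ y∈ (B'⊆p (p─q⊆p _ _ y∈)))
... | inj₂ B'∩p  = subst P (sym (disjoint⇒─≡ B'∩p)) PB'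

module Pre {_⟶_ : Rel (Fin n) 0ℓ} (_⟶?_ : Decidable _⟶_) where

  does≡true⇒ : ∀ {A : Set} (a? : Dec A) → does a? ≡ true → A
  does≡true⇒ (yes a) _  = a
  does≡true⇒ (no _)  ()

  ∈pre⁻ : x ∈ pre _⟶?_ q → ∃ λ y → x ⟶ y × y ∈ q
  ∈pre⁻ {x = x} {q = q} x∈ =
    does≡true⇒ (any? λ y → (x ⟶? y) ×-dec (y ∈? q))
                (trans (sym (lookup∘tabulate _ x)) ([]=⇒lookup x∈))

  ∈pre⁺ : x ⟶ y → y ∈ q → x ∈ pre _⟶?_ q
  ∈pre⁺ {x = x} {q = q} x⟶y y∈q = lookup⇒[]= x _
    (trans (lookup∘tabulate _ x) (dec-true (any? λ y → (x ⟶? y) ×-dec (y ∈? q)) (_ , x⟶y , y∈q)))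

  pre-mono : p ⊆ q → pre _⟶?_ p ⊆ pre _⟶?_ q
  pre-mono p⊆q x∈ with ∈pre⁻ x∈
  ... | _ , x⟶y , y∈p = ∈pre⁺ x⟶y (p⊆q y∈p)

  pre-⊥ : pre _⟶?_ ⊥ ≡ ⊥
  pre-⊥ = Empty-unique λ (_ , x∈) → ∉⊥ (proj₂ (proj₂ (∈pre⁻ x∈)))

  pre-∪ : pre _⟶?_ (p ∪ q) ≡ pre _⟶?_ p ∪ pre _⟶?_ q
  pre-∪ {p = p} {q = q} = subset-ext λ x → mk⇔ distribute join
    where
    distribute : x ∈ pre _⟶?_ (p ∪ q) → x ∈ pre _⟶?_ p ∪ pre _⟶?_ q
    distribute x∈ with ∈pre⁻ x∈
    ... | _ , x⟶y , y∈ = x∈p∪q⁺ (Sum.map (∈pre⁺ x⟶y) (∈pre⁺ x⟶y) (x∈p∪q⁻ p q y∈))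

    join : x ∈ pre _⟶?_ p ∪ pre _⟶?_ q → x ∈ pre _⟶?_ (p ∪ q)
    join x∈ = [ pre-mono (p⊆p∪q q) , pre-mono (q⊆p∪q p q) ]′ (x∈p∪q⁻ _ _ x∈)

  stable⇒saturated-pre : PTstable _⟶?_ P → pad P q → Saturated P (pre _⟶?_ q)
  stable⇒saturated-pre {P = P} st (_ , Pps , refl) = saturated-pre-⋃ Pps
    where
    saturated-pre-⋃ : ∀ {ps} → All P ps → Saturated P (pre _⟶?_ (⋃ ps))
    saturated-pre-⋃ []         = subst (Saturated P) (sym pre-⊥) saturated-⊥
    saturated-pre-⋃ (PC ∷ PCs) =
      subst (Saturated P) (sym pre-∪) (saturated-∪ (λ B PB → st B _ PB PC) (saturated-pre-⋃ PCs))

open Pre using (stable⇒saturated-pre)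

module Partition {P : Family n} (isP : IsPartition P) where

  private
    nonempty : P B → Nonempty B
    nonempty = proj₁ isP _

    blockOf : (x : Fin n) → ∃ λ B → P B × x ∈ B
    blockOf = proj₁ (proj₂ isP)

    unique : ∀ {B B'} → P B → P B' → x ∈ B → x ∈ B' → B ≡ B'
    unique PB PB' = proj₂ (proj₂ isP) _ _ _ PB PB'

  ≈-block : P B → s ∈ B → s ≈[ P ] s' ⇔ s' ∈ B
  ≈-block {s = s} {s' = s'} PB s∈B = mk⇔ (λ e → to (e _ PB) s∈B) λ s'∈B q Pq →
    mk⇔ (λ s∈q → subst (s' ∈_) (unique PB Pq s∈B s∈q) s'∈B)
        (λ s'∈q → subst (s ∈_) (unique PB Pq s'∈B s'∈q) s∈B)

  class-∩ : P B → s ∈ B → s ∈ p → Class (P ∪ᶠ ｛ p ｝) s (B ∩ p)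
  class-∩ {B = B} {s = s} {p = p} PB s∈B s∈p s' = begin
    s' ∈ B ∩ p                        ∼⟨ x∈p∩q⇔ ⟩
    (s' ∈ B × s' ∈ p)                 ∼⟨ ⇔-sym (≈-block PB s∈B) ×-⇔ ∈-agree s∈p ⟩
    (s ≈[ P ] s' × (s ∈ p ⇔ s' ∈ p))  ∼⟨ ⇔-sym ≈-∪｛｝ ⟩
    s ≈[ P ∪ᶠ ｛ p ｝ ] s'            ∎
    where open EquationalReasoning

  class-─ : P B → s ∈ B → s ∉ p → Class (P ∪ᶠ ｛ p ｝) s (B ─ p)
  class-─ {B = B} {s = s} {p = p} PB s∈B s∉p s' = begin
    s' ∈ B ─ p                        ∼⟨ x∈p─q⇔ ⟩
    (s' ∈ B × s' ∉ p)                 ∼⟨ ⇔-sym (≈-block PB s∈B) ×-⇔ ∉-agree s∉p ⟩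
    (s ≈[ P ] s' × (s ∈ p ⇔ s' ∈ p))  ∼⟨ ⇔-sym ≈-∪｛｝ ⟩
    s ≈[ P ∪ᶠ ｛ p ｝ ] s'            ∎
    where open EquationalReasoning

  splitBy⇒par : splitBy P p B → par (P ∪ᶠ ｛ p ｝) B
  splitBy⇒par ((B' , PB' , inj₁ refl) , y , y∈) =
    from par⇔ (y , class-∩ PB' (p∩q⊆p _ _ y∈) (p∩q⊆q _ _ y∈))
  splitBy⇒par ((B' , PB' , inj₂ refl) , y , y∈) =
    from par⇔ (y , class-─ PB' (p─q⊆p _ _ y∈) (x∈p─q⇒x∉q _ _ y∈))

  par⇒splitBy : par (P ∪ᶠ ｛ p ｝) B → splitBy P p B
  par⇒splitBy {p = p} parB with to par⇔ parB
  ... | s , c with blockOf s | s ∈? p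
  ... | B' , PB' , s∈B' | yes s∈p =
    (B' , PB' , inj₁ (class-unique c (class-∩ PB' s∈B' s∈p))) , s , class-∈ c
  ... | B' , PB' , s∈B' | no s∉p =
    (B' , PB' , inj₂ (class-unique c (class-─ PB' s∈B' s∉p))) , s , class-∈ c

  splitBy≐par-M-pad : splitBy P p ≐ par (M (pad P ∪ᶠ ｛ p ｝))
  splitBy≐par-M-pad =
    ≐-trans (λ B → mk⇔ splitBy⇒par par⇒splitBy)
            (par-cong (≋-sym (≋-trans M-≋ (∪-≋ pad-≋ ≋-refl))))

  par≺⇔splits : (par (M (pad P ∪ᶠ ｛ p ｝)) ≺ P) ⇔ (¬ (splitBy P p ≐ P))
  par≺⇔splits =
    mk⇔ (λ (_ , par≉P) splitBy≐P → par≉P (≐-trans (≐-sym splitBy≐par-M-pad) splitBy≐P))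
        (λ splits → (λ B parB → splitBy-⪯ B (from (splitBy≐par-M-pad B) parB))
                  , λ par≐P → splits (≐-trans splitBy≐par-M-pad par≐P))

  saturated⇒splitBy≐ : Saturated P p → splitBy P p ≐ P
  saturated⇒splitBy≐ {p = p} sat B = mk⇔ (splitBy⇒block sat) block⇒splitBy
    where
    block⇒splitBy : P B → splitBy P p B
    block⇒splitBy PB with sat B PB
    ... | inj₁ B⊆p = (B , PB , inj₁ (sym (⊆⇒∩≡ B⊆p))) , nonempty PB
    ... | inj₂ B∩p = (B , PB , inj₂ (sym (disjoint⇒─≡ B∩p))) , nonempty PB

  splitBy≐⇒saturated : splitBy P p ≐ P → Saturated P p
  splitBy≐⇒saturated {p = p} e B PB with nonempty? (B ∩ p)
  ... | no  B∩p       = inj₂ B∩p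
  ... | yes (x , x∈) = inj₁ λ y∈B → p∩q⊆q _ _ (subst (_ ∈_) (sym B∩p≡B) y∈B)
    where
    B∩p≡B : B ∩ p ≡ B
    B∩p≡B = unique (to (e _) ((B , PB , inj₁ refl) , x , x∈)) PB x∈ (p∩q⊆p _ _ x∈)

  PTstable⇔no-pad-refiner : ∀ {_⟶_ : Rel (Fin n) 0ℓ} (_⟶?_ : Decidable _⟶_) →
    PTstable _⟶?_ P ⇔ (∀ S → ¬ (pad P S × par (M (pad P ∪ᶠ ｛ pre _⟶?_ S ｝)) ≺ P))
  PTstable⇔no-pad-refiner _⟶?_ = mk⇔
    (λ st S (padS , par≺P) →
       to par≺⇔splits par≺P (saturated⇒splitBy≐ (stable⇒saturated-pre _⟶?_ st padS)))
    -- The dichotomy for B, B' is decidable, so it suffices to refute its failure,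
    -- which would make B' a refiner.
    (λ h B B' PB PB' → decidable-stable (B ⊆? pre _⟶?_ B' ⊎-dec ¬? (nonempty? _)) λ fails →
       h B' (⊆pad PB' , from par≺⇔splits λ e → fails (splitBy≐⇒saturated e B PB)))

lemma4p1 : ∀ {n} (_⟶_ : Rel (Fin n) 0ℓ) (_⟶?_ : Decidable _⟶_) → Total _⟶_ →
    ∀ (P : Family n) → IsPartition P →
      (∀ (S : Subset n) →
        (split _⟶?_ S P ≐ par (M (pad P ∪ᶠ ｛ pre _⟶?_ S ｝))) ×
        (par (M (pad P ∪ᶠ ｛ pre _⟶?_ S ｝)) ≐ par (pad P ⊓ M ｛ pre _⟶?_ S ｝))) ×
      (∀ (S : Subset n) →
        PTrefiners _⟶?_ P S ⇔ (pad P S × (par (M (pad P ∪ᶠ ｛ pre _⟶?_ S ｝)) ≺ P))) ×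
      (PTstable _⟶?_ P ⇔
        (∀ (S : Subset n) → ¬ (pad P S × (par (M (pad P ∪ᶠ ｛ pre _⟶?_ S ｝)) ≺ P))))
lemma4p1 _ _⟶?_ _ P isP =
  (λ S → splitBy≐par-M-pad , par-M≐par-⊓) ,
  (λ S → mk⇔ (λ (splits , padS) → padS , from par≺⇔splits splits)
             (λ (padS , par≺P) → to par≺⇔splits par≺P , padS)) ,
  PTstable⇔no-pad-refiner _⟶?_
  where open Partition isP
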